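{- For every integers $n\ge 0$ and $m\ge 1$, $$n!\sum_{k=m}^{\infty}\frac{1}{k(k+1)\cdots(k+n)}\begin{bmatrix}k\\ m\end{bmatrix}\frac{1}{k!}=\zeta(m+1,n+1)=\zeta(m+1)-H_n^{(m+1)}.$$
   Context: $\begin{bmatrix}k\\ m\end{bmatrix}$ denotes the unsigned Stirling number of the first kind (number of permutations of $k$ elements with exactly $m$ cycles), equivalently defined by $[-\ln(1-x)]^m=m!\sum_{k\ge m}\begin{bmatrix}k\\ m\end{bmatrix}\frac{x^k}{k!}$. $\zeta(s,a)=\sum_{k=0}^\infty (k+a)^{ -s}$ is the Hurwitz zeta function, $\zeta(s)$ the Riemann zeta function, and $H_n^{(q)}=\sum_{j=1}^n j^{ -q}$ (with $H_0^{(q)}=0$). For $n=0$ the product $k(k+1)\cdots(k+n)$ equals $k$. -}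

module Defs where

open import Data.Nat as ℕ using (ℕ; zero; suc; _^_; _!)
open import Data.Integer using (+_)
open import Data.Rational using (ℚ; 0ℚ; _/_; _+_; _*_; _-_)

-- Unsigned Stirling numbers of the first kind [k m] (permutations of k
-- elements with exactly m cycles), via the standard recurrence
-- [k+1, m+1] = k [k, m+1] + [k, m],  [0,0] = 1, [0,m+1] = [k+1,0] = 0.
stirling1 : ℕ → ℕ → ℕ
stirling1 zero    zero    = 1
stirling1 zero    (suc m) = 0
stirling1 (suc k) zero    = 0
stirling1 (suc k) (suc m) = k ℕ.* stirling1 k (suc m) ℕ.+ stirling1 k m

-- rising k n = k (k+1) ... (k+n)   (equals k when n = 0)
rising : ℕ → ℕ → ℕ
rising k zero    = k
rising k (suc n) = rising k n ℕ.* (k ℕ.+ suc n)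

-- a / d as a rational, totalised by a / 0 = 0 (only used with d > 0)
_÷_ : ℕ → ℕ → ℚ
a ÷ zero  = 0ℚ
a ÷ suc d = (+ a) / suc d

sumBelow : ℕ → (ℕ → ℚ) → ℚ
sumBelow zero    f = 0ℚ
sumBelow (suc N) f = sumBelow N f + f N

-- K-th partial sum of  n! ∑_{k≥m} [k m] / (k(k+1)...(k+n) k!)
-- (terms k = m, ..., m+K-1)
lhsPartial : ℕ → ℕ → ℕ → ℚ
lhsPartial n m K =
  sumBelow K (λ i → (n ! ℕ.* stirling1 (m ℕ.+ i) m)
                     ÷ (rising (m ℕ.+ i) n ℕ.* (m ℕ.+ i) !))

hurwitzPartial : ℕ → ℕ → ℕ → ℚ
hurwitzPartial s a K = sumBelow K (λ j → 1 ÷ ((j ℕ.+ a) ^ s))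

zetaPartial : ℕ → ℕ → ℚ
zetaPartial s K = sumBelow K (λ j → 1 ÷ (suc j ^ s))

harmonic : ℕ → ℕ → ℚ
harmonic q n = sumBelow n (λ j → 1 ÷ (suc j ^ q))

{-# OPTIONS --safe #-}
-- With T p k = p! [k m] / (k (k+1) ⋯ (k+p) k!), partial fractions give
-- T p k = p! [k m] / (k+p+1)! + T (p+1) k, so the left-hand side telescopes into
-- Σ_{j<J} Σ_k (n+j)! [k m] / (k+n+j+1)! plus the tail Σ_k T (n+J) k, which is O(1/J) as [k m] ≤ k!.
-- Summing by parts with the Stirling recurrence evaluates each inner sum to (n+j+1)^−(m+1)
-- up to boundary terms [K, i] / K! (i ≤ m); these tend to 0 because [K, i] 2^K ≤ 2^i · 1·3⋯(2K−1)
-- and (1·3⋯(2K−1))² (2K+1) ≤ (2^K K!)². Partial sums of Σ (t+a)^−s with s ≥ 2 are Cauchy with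
-- modulus 2/(N+1) by comparison with Σ 1/((t+1)(t+2)), and shifting the index gives ζ(s) − H_n^(s).
module Submission where

open import Defs

module Fraction where

  open import Data.Nat using (zero; suc; _+_; _*_; _≤_; _<_; NonZero; z≤n)
  import Data.Nat.Properties as ℕ
  open import Data.Nat.Tactic.RingSolver using (solve-∀)
  open import Data.Integer using (+_; +≤+; +<+)
  import Data.Integer as ℤ
  import Data.Integer.Properties as ℤ
  open import Data.Rational as ℚ using (0ℚ; toℚᵘ)
  import Data.Rational.Properties as ℚ
  import Data.Rational.Unnormalised as ℚᵘ
  import Data.Rational.Unnormalised.Properties as ℚᵘ
  open import Relation.Binary.PropositionalEquality

  private
    toℚᵘ-÷ : ∀ a d → toℚᵘ (a ÷ suc d) ℚᵘ.≃ ℚᵘ.mkℚᵘ (+ a) d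
    toℚᵘ-÷ a d = ℚ.toℚᵘ-fromℚᵘ (ℚᵘ.mkℚᵘ (+ a) d)

    +-* : ∀ a b → + a ℤ.* + b ≡ + (a * b)
    +-* a b = sym (ℤ.pos-* a b)

  ÷-≡ : ∀ a b c d .{{_ : NonZero b}} .{{_ : NonZero d}} → a * d ≡ c * b → a ÷ b ≡ c ÷ d
  ÷-≡ a (suc b) c (suc d) eq = ℚ.toℚᵘ-injective (ℚᵘ.≃-trans (toℚᵘ-÷ a b)
    (ℚᵘ.≃-trans (ℚᵘ.*≡* (trans (+-* a (suc d)) (trans (cong +_ eq) (sym (+-* c (suc b))))))
      (ℚᵘ.≃-sym (toℚᵘ-÷ c d))))

  ÷-mono-≤ : ∀ a b c d .{{_ : NonZero b}} .{{_ : NonZero d}} → a * d ≤ c * b → a ÷ b ℚ.≤ c ÷ d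
  ÷-mono-≤ a (suc b) c (suc d) le = ℚ.toℚᵘ-cancel-≤
    (ℚᵘ.≤-respˡ-≃ (ℚᵘ.≃-sym (toℚᵘ-÷ a b)) (ℚᵘ.≤-respʳ-≃ (ℚᵘ.≃-sym (toℚᵘ-÷ c d))
      (ℚᵘ.*≤* (subst₂ ℤ._≤_ (sym (+-* a (suc d))) (sym (+-* c (suc b))) (+≤+ le)))))

  ÷-mono-< : ∀ a b c d .{{_ : NonZero b}} .{{_ : NonZero d}} → a * d < c * b → a ÷ b ℚ.< c ÷ d
  ÷-mono-< a (suc b) c (suc d) lt = ℚ.toℚᵘ-cancel-<
    (ℚᵘ.<-respˡ-≃ (ℚᵘ.≃-sym (toℚᵘ-÷ a b)) (ℚᵘ.<-respʳ-≃ (ℚᵘ.≃-sym (toℚᵘ-÷ c d))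
      (ℚᵘ.*<* (subst₂ ℤ._<_ (sym (+-* a (suc d))) (sym (+-* c (suc b))) (+<+ lt)))))

  ÷-+-÷ : ∀ a b c d .{{_ : NonZero b}} .{{_ : NonZero d}} →
          a ÷ b ℚ.+ c ÷ d ≡ (a * d + c * b) ÷ (b * d)
  ÷-+-÷ a (suc b) c (suc d) = ℚ.toℚᵘ-injective
    (ℚᵘ.≃-trans (ℚ.toℚᵘ-homo-+ (a ÷ suc b) (c ÷ suc d))
    (ℚᵘ.≃-trans (ℚᵘ.+-cong (toℚᵘ-÷ a b) (toℚᵘ-÷ c d))
    (ℚᵘ.≃-trans (ℚᵘ.*≡* (cong (ℤ._* + suc (d + b * suc d)) numerator))
      (ℚᵘ.≃-sym (toℚᵘ-÷ (a * suc d + c * suc b) (d + b * suc d))))))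
    where
    numerator : + a ℤ.* + suc d ℤ.+ + c ℤ.* + suc b ≡ + (a * suc d + c * suc b)
    numerator = trans (cong₂ ℤ._+_ (+-* a (suc d)) (+-* c (suc b))) (sym (ℤ.pos-+ (a * suc d) (c * suc b)))

  ÷-*-÷ : ∀ a b c d .{{_ : NonZero b}} .{{_ : NonZero d}} → a ÷ b ℚ.* c ÷ d ≡ (a * c) ÷ (b * d)
  ÷-*-÷ a (suc b) c (suc d) = ℚ.toℚᵘ-injective
    (ℚᵘ.≃-trans (ℚ.toℚᵘ-homo-* (a ÷ suc b) (c ÷ suc d))
    (ℚᵘ.≃-trans (ℚᵘ.*-cong (toℚᵘ-÷ a b) (toℚᵘ-÷ c d))
    (ℚᵘ.≃-trans (ℚᵘ.*≡* (cong (ℤ._* + suc (d + b * suc d)) (+-* a c)))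
      (ℚᵘ.≃-sym (toℚᵘ-÷ (a * c) (d + b * suc d))))))

  0≤÷ : ∀ a b → 0ℚ ℚ.≤ a ÷ b
  0≤÷ a zero    = ℚ.≤-refl
  0≤÷ a (suc b) = ÷-mono-≤ 0 1 a (suc b) z≤n

  0÷ : ∀ a b → a ≡ 0 → a ÷ b ≡ 0ℚ
  0÷ .0 zero    refl = refl
  0÷ .0 (suc b) refl = ℚ.0/n≡0 (suc b)

  ÷-partial-fractions : ∀ c d t .{{_ : NonZero d}} →
    c ÷ (d * (suc t * suc (suc t))) ℚ.+ c ÷ (d * suc (suc t)) ≡ c ÷ (d * suc t)
  ÷-partial-fractions c d t {{d≢0}} =
    trans (÷-+-÷ c (d * (suc t * suc (suc t))) c (d * suc (suc t)) {{ℕ.m*n≢0 d _}} {{ℕ.m*n≢0 d _}})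
          (÷-≡ _ _ c (d * suc t) {{ℕ.m*n≢0 _ _ {{ℕ.m*n≢0 d _}} {{ℕ.m*n≢0 d _}}}} {{ℕ.m*n≢0 d _}} (cross c d t))
    where
    cross : ∀ c d t → (c * (d * suc (suc t)) + c * (d * (suc t * suc (suc t)))) * (d * suc t)
                    ≡ c * (d * (suc t * suc (suc t)) * (d * suc (suc t)))
    cross = solve-∀

  ÷-inverseˡ : ∀ b .{{_ : NonZero b}} → 1 ÷ b ℚ.* b ÷ 1 ≡ ℚ.1ℚ
  ÷-inverseˡ b = trans (÷-*-÷ 1 b b 1) (÷-≡ (1 * b) (b * 1) 1 1 {{ℕ.m*n≢0 b 1}} (cross b))
    where
    cross : ∀ b → 1 * b * 1 ≡ 1 * (b * 1)
    cross = solve-∀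

  ÷-inverseˡ-≤ : ∀ a b .{{_ : NonZero b}} → a ≤ b → 1 ÷ b ℚ.* a ÷ 1 ℚ.≤ ℚ.1ℚ
  ÷-inverseˡ-≤ a b a≤b = ℚ.≤-trans (ℚ.≤-reflexive (÷-*-÷ 1 b a 1))
    (÷-mono-≤ (1 * a) (b * 1) 1 1 {{ℕ.m*n≢0 b 1}} (subst₂ _≤_ (sym (unit a)) (sym (unit′ b)) a≤b))
    where
    unit : ∀ a → 1 * a * 1 ≡ a
    unit = solve-∀
    unit′ : ∀ b → 1 * (b * 1) ≡ b
    unit′ = solve-∀

module Approximation where

  open Fraction
  open import Data.Nat as ℕ using (suc)
  import Data.Nat.Properties as ℕ
  open import Data.Integer using (+[1+_]; +0; -[1+_]; +<+)
  open import Data.Rational using (ℚ; mkℚ; 0ℚ; _+_; _-_; -_; _≤_; _<_; ∣_∣; *<*)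
  open import Data.Rational.Properties
  open import Data.Rational.Solver using (module +-*-Solver)
  open import Data.Product using (_×_; _,_; ∃)
  open import Data.Sum using (inj₁; inj₂)
  open import Relation.Binary.PropositionalEquality
  open +-*-Solver

  infix 4 _≈[_]_

  _≈[_]_ : ℚ → ℚ → ℚ → Set
  x ≈[ e ] y = x ≤ y + e × y ≤ x + e

  p≤p+q : ∀ {p q} → 0ℚ ≤ q → p ≤ p + q
  p≤p+q {p} 0≤q = ≤-trans (≤-reflexive (sym (+-identityʳ p))) (+-monoʳ-≤ p 0≤q)

  private
    ≤+⇒-≤ : ∀ {a b c} → a ≤ b + c → a - b ≤ c
    ≤+⇒-≤ {a} {b} {c} le = ≤-trans (+-monoˡ-≤ (- b) le)
      (≤-reflexive (solve 2 (λ b c → (b :+ c) :- b := c) refl b c))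

  ≈-refl : ∀ {x e} → 0ℚ ≤ e → x ≈[ e ] x
  ≈-refl 0≤e = p≤p+q 0≤e , p≤p+q 0≤e

  ≈-sym : ∀ {x y e} → x ≈[ e ] y → y ≈[ e ] x
  ≈-sym (x≤y+e , y≤x+e) = y≤x+e , x≤y+e

  ≈-weaken : ∀ {x y e f} → e ≤ f → x ≈[ e ] y → x ≈[ f ] y
  ≈-weaken {x} {y} e≤f (x≤y+e , y≤x+e) =
    ≤-trans x≤y+e (+-monoʳ-≤ y e≤f) , ≤-trans y≤x+e (+-monoʳ-≤ x e≤f)

  ≈-+ : ∀ {x y e x′ y′ e′} → x ≈[ e ] y → x′ ≈[ e′ ] y′ → x + x′ ≈[ e + e′ ] y + y′
  ≈-+ {x} {y} {e} {x′} {y′} {e′} (l , r) (l′ , r′) =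
    ≤-trans (+-mono-≤ l l′) (≤-reflexive (swap y e y′ e′)) ,
    ≤-trans (+-mono-≤ r r′) (≤-reflexive (swap x e x′ e′))
    where
    swap : ∀ a b c d → (a + b) + (c + d) ≡ (a + c) + (b + d)
    swap = solve 4 (λ a b c d → (a :+ b) :+ (c :+ d) := (a :+ c) :+ (b :+ d)) refl

  ≈-trans : ∀ {x y z e f} → x ≈[ e ] y → y ≈[ f ] z → x ≈[ e + f ] z
  ≈-trans {x} {y} {z} {e} {f} (x≤y+e , y≤x+e) (y≤z+f , z≤y+f) =
    ≤-trans x≤y+e (≤-trans (+-monoˡ-≤ e y≤z+f) (≤-reflexive (rearrange z f e))) ,
    ≤-trans z≤y+f (≤-trans (+-monoˡ-≤ f y≤x+e) (≤-reflexive (trans (rearrange x e f) (cong (x +_) (+-comm f e)))))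
    where
    rearrange : ∀ a b c → (a + b) + c ≡ a + (c + b)
    rearrange = solve 3 (λ a b c → (a :+ b) :+ c := a :+ (c :+ b)) refl

  ≈-−ʳ : ∀ {x y e} h → x ≈[ e ] y → x - h ≈[ e ] y - h
  ≈-−ʳ {x} {y} {e} h (x≤y+e , y≤x+e) =
    ≤-trans (+-monoˡ-≤ (- h) x≤y+e) (≤-reflexive (shift y)) ,
    ≤-trans (+-monoˡ-≤ (- h) y≤x+e) (≤-reflexive (shift x))
    where
    shift : ∀ a → (a + e) - h ≡ (a - h) + e
    shift a = solve 3 (λ a e h → (a :+ e) :- h := (a :- h) :+ e) refl a e h

  +≈ : ∀ {x y e} → 0ℚ ≤ y → y ≤ e → x + y ≈[ e ] x
  +≈ {x} {y} 0≤y y≤e = +-monoʳ-≤ x y≤e , ≤-trans (p≤p+q 0≤y) (p≤p+q (≤-trans 0≤y y≤e))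

  ≈⇒∣-∣≤ : ∀ {x y e} → x ≈[ e ] y → ∣ x - y ∣ ≤ e
  ≈⇒∣-∣≤ {x} {y} {e} (x≤y+e , y≤x+e) with ∣p∣≡p∨∣p∣≡-p (x - y)
  ... | inj₁ ∣x-y∣≡x-y = subst (_≤ e) (sym ∣x-y∣≡x-y) (≤+⇒-≤ x≤y+e)
  ... | inj₂ ∣x-y∣≡y-x = subst (_≤ e) (sym ∣x-y∣≡y-x)
    (subst (_≤ e) (solve 2 (λ x y → y :- x := :- (x :- y)) refl x y) (≤+⇒-≤ y≤x+e))

  archimedean : ∀ ε → 0ℚ < ε → ∃ λ M → 1 ÷ suc M < ε
  archimedean ε@(mkℚ +[1+ a ] d _) _ = suc d ,
    subst (1 ÷ suc (suc d) <_) (↥p/↧p≡p ε) (÷-mono-< 1 (suc (suc d)) (suc a) (suc d)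
      (ℕ.≤-trans (ℕ.s≤s (ℕ.≤-reflexive (ℕ.*-identityˡ (suc d)))) (ℕ.m≤n*m (suc (suc d)) (suc a))))
  archimedean (mkℚ +0 _ _) (*<* (+<+ ()))
  archimedean (mkℚ -[1+ _ ] _ _) (*<* ())

module FiniteSum where

  open Fraction
  open Approximation
  open import Data.Nat as ℕ using (ℕ; zero; suc; NonZero)
  import Data.Nat.Properties as ℕ
  open import Data.Nat.Tactic.RingSolver using (solve-∀)
  open import Data.Rational using (ℚ; 0ℚ; 1ℚ; _+_; _*_; _≤_)
  open import Data.Rational.Properties
  open import Data.Rational.Solver using (module +-*-Solver)
  open import Data.Product using (_,_)
  open import Relation.Binary.PropositionalEquality
  open +-*-Solver

  sum-cong : ∀ K {f g} → (∀ i → i ℕ.< K → f i ≡ g i) → sumBelow K f ≡ sumBelow K g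
  sum-cong zero    f≡g = refl
  sum-cong (suc K) f≡g = cong₂ _+_ (sum-cong K (λ i i<K → f≡g i (ℕ.m≤n⇒m≤1+n i<K))) (f≡g K ℕ.≤-refl)

  sum-mono : ∀ K {f g} → (∀ i → i ℕ.< K → f i ≤ g i) → sumBelow K f ≤ sumBelow K g
  sum-mono zero    f≤g = ≤-refl
  sum-mono (suc K) f≤g = +-mono-≤ (sum-mono K (λ i i<K → f≤g i (ℕ.m≤n⇒m≤1+n i<K))) (f≤g K ℕ.≤-refl)

  0≤sum : ∀ K {f} → (∀ i → 0ℚ ≤ f i) → 0ℚ ≤ sumBelow K f
  0≤sum zero    0≤f = ≤-refl
  0≤sum (suc K) 0≤f = +-mono-≤ (0≤sum K 0≤f) (0≤f K)

  sum-zero : ∀ K → sumBelow K (λ _ → 0ℚ) ≡ 0ℚ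
  sum-zero zero    = refl
  sum-zero (suc K) = cong (_+ 0ℚ) (sum-zero K)

  sum-+ : ∀ K f g → sumBelow K (λ i → f i + g i) ≡ sumBelow K f + sumBelow K g
  sum-+ zero    f g = refl
  sum-+ (suc K) f g = trans (cong (_+ (f K + g K)) (sum-+ K f g))
    (solve 4 (λ a b c d → (a :+ b) :+ (c :+ d) := (a :+ c) :+ (b :+ d)) refl
       (sumBelow K f) (sumBelow K g) (f K) (g K))

  *-distribˡ-sum : ∀ c K f → c * sumBelow K f ≡ sumBelow K (λ i → c * f i)
  *-distribˡ-sum c zero    f = *-zeroʳ c
  *-distribˡ-sum c (suc K) f = trans (*-distribˡ-+ c (sumBelow K f) (f K)) (cong (_+ c * f K) (*-distribˡ-sum c K f))

  sum-split : ∀ a K f → sumBelow (a ℕ.+ K) f ≡ sumBelow a f + sumBelow K (λ i → f (a ℕ.+ i))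
  sum-split a zero    f = trans (cong (λ n → sumBelow n f) (ℕ.+-identityʳ a)) (sym (+-identityʳ _))
  sum-split a (suc K) f = trans (cong (λ n → sumBelow n f) (ℕ.+-suc a K))
    (trans (cong (_+ f (a ℕ.+ K)) (sum-split a K f)) (+-assoc (sumBelow a f) _ _))

  sum-≈ : ∀ K {f g e} → (∀ i → f i ≈[ e i ] g i) → sumBelow K f ≈[ sumBelow K e ] sumBelow K g
  sum-≈ zero    f≈g = ≈-refl ≤-refl
  sum-≈ (suc K) f≈g = ≈-+ (sum-≈ K f≈g) (f≈g K)

  sum-const : ∀ K c → sumBelow K (λ _ → c) ≡ K ÷ 1 * c
  sum-const zero    c = sym (*-zeroˡ c)
  sum-const (suc K) c = begin
    sumBelow K (λ _ → c) + c       ≡⟨ cong₂ _+_ (sum-const K c) (sym (*-identityˡ c)) ⟩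
    K ÷ 1 * c + 1ℚ * c             ≡⟨ *-distribʳ-+ c (K ÷ 1) 1ℚ ⟨
    (K ÷ 1 + 1 ÷ 1) * c            ≡⟨ cong (_* c) (trans (÷-+-÷ K 1 1 1) (÷-≡ (K ℕ.* 1 ℕ.+ 1 ℕ.* 1) 1 (suc K) 1 (succ K))) ⟩
    suc K ÷ 1 * c                  ∎
    where
    open ≡-Reasoning
    succ : ∀ K → (K ℕ.* 1 ℕ.+ 1 ℕ.* 1) ℕ.* 1 ≡ suc K ℕ.* (1 ℕ.* 1)
    succ = solve-∀

  sum-const-÷ : ∀ n a b .{{_ : NonZero n}} .{{_ : NonZero b}} →
                sumBelow n (λ _ → a ÷ (n ℕ.* b)) ≡ a ÷ b
  sum-const-÷ n a b {{n≢0}} {{b≢0}} = begin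
    sumBelow n (λ _ → a ÷ (n ℕ.* b))  ≡⟨ sum-const n (a ÷ (n ℕ.* b)) ⟩
    n ÷ 1 * a ÷ (n ℕ.* b)            ≡⟨ ÷-*-÷ n 1 a (n ℕ.* b) {{_}} {{nb≢0}} ⟩
    (n ℕ.* a) ÷ (1 ℕ.* (n ℕ.* b))    ≡⟨ ÷-≡ (n ℕ.* a) (1 ℕ.* (n ℕ.* b)) a b {{ℕ.m*n≢0 1 (n ℕ.* b) {{_}} {{nb≢0}}}} (cross n a b) ⟩
    a ÷ b                            ∎
    where
    open ≡-Reasoning
    nb≢0 : NonZero (n ℕ.* b)
    nb≢0 = ℕ.m*n≢0 n b
    cross : ∀ n a b → n ℕ.* a ℕ.* b ≡ a ℕ.* (1 ℕ.* (n ℕ.* b))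
    cross = solve-∀

  module _ {f g : ℕ → ℚ} (step : ∀ t → f t + g (suc t) ≤ g t) where

    sum-telescope : ∀ N d → sumBelow (N ℕ.+ d) f + g (N ℕ.+ d) ≤ sumBelow N f + g N
    sum-telescope N zero    = ≤-reflexive (cong (λ n → sumBelow n f + g n) (ℕ.+-identityʳ N))
    sum-telescope N (suc d) = subst (λ n → sumBelow n f + g n ≤ sumBelow N f + g N) (sym (ℕ.+-suc N d))
      (≤-trans (≤-reflexive (+-assoc (sumBelow (N ℕ.+ d) f) _ _))
      (≤-trans (+-monoʳ-≤ (sumBelow (N ℕ.+ d) f) (step (N ℕ.+ d))) (sum-telescope N d)))

    sum-tail-≈ : (∀ t → 0ℚ ≤ f t) → (∀ t → 0ℚ ≤ g t) →
                 ∀ {N K} → N ℕ.≤ K → sumBelow N f ≈[ g N ] sumBelow K f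
    sum-tail-≈ 0≤f 0≤g {N} {K} N≤K = subst (λ K → sumBelow N f ≈[ g N ] sumBelow K f) (ℕ.m+[n∸m]≡n N≤K)
      (≤-trans (sum-mono-+ N d) (p≤p+q (0≤g N)) ,
       ≤-trans (p≤p+q (0≤g (N ℕ.+ d))) (sum-telescope N d))
      where
      d = K ℕ.∸ N
      sum-mono-+ : ∀ N d → sumBelow N f ≤ sumBelow (N ℕ.+ d) f
      sum-mono-+ N d = ≤-trans (≤-reflexive (sym (+-identityʳ _)))
        (≤-trans (+-monoʳ-≤ (sumBelow N f) (0≤sum d (λ i → 0≤f (N ℕ.+ i)))) (≤-reflexive (sym (sum-split N d f))))

module StirlingBounds where

  open import Data.Nat
  open import Data.Nat.Properties
  open import Data.Nat.Combinatorics using (k![n∸k]!∣n!)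
  open import Data.Nat.Divisibility using (_∣_; ∣⇒≤)
  open import Data.Nat.Tactic.RingSolver using (solve-∀)
  open import Relation.Binary.PropositionalEquality
  open import Relation.Nullary using (yes; no; contradiction)

  stirling1-< : ∀ {k m} → k < m → stirling1 k m ≡ 0
  stirling1-< {zero}  {suc m}       _         = refl
  stirling1-< {suc k} {suc (suc m)} (s≤s k<m) =
    trans (cong₂ _+_ (cong (k *_) (stirling1-< (m<n⇒m<1+n k<m))) (stirling1-< k<m)) (cong (_+ 0) (*-zeroʳ k))

  stirling1≤! : ∀ k m → stirling1 k m ≤ k !
  stirling1≤! zero    zero    = ≤-refl
  stirling1≤! zero    (suc m) = z≤n
  stirling1≤! (suc k) zero    = z≤n
  stirling1≤! (suc k) (suc m) = begin
    k * stirling1 k (suc m) + stirling1 k m  ≤⟨ +-mono-≤ (*-monoʳ-≤ k (stirling1≤! k (suc m))) (stirling1≤! k m) ⟩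
    k * k ! + k !                            ≡⟨ +-comm (k * k !) (k !) ⟩
    suc k !                                  ∎
    where open ≤-Reasoning

  !*!≤! : ∀ p K → p ! * K ! ≤ (K + p) !
  !*!≤! p K = ∣⇒≤ {{(K + p) !≢0}}
    (subst (λ n → p ! * n ! ∣ (K + p) !) (m+n∸n≡m K p) (k![n∸k]!∣n! (m≤n+m p K)))

  oddProduct : ℕ → ℕ
  oddProduct zero    = 1
  oddProduct (suc K) = oddProduct K * suc (2 * K)

  -- Σᵢ [K, i] xⁱ = x (x + 1) ⋯ (x + K − 1); this is one coefficient of it at x = 1/2.
  stirling1*2^≤ : ∀ K i → stirling1 K i * 2 ^ K ≤ 2 ^ i * oddProduct K
  stirling1*2^≤ zero    zero    = ≤-refl
  stirling1*2^≤ zero    (suc i) = z≤n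
  stirling1*2^≤ (suc K) zero    = z≤n
  stirling1*2^≤ (suc K) (suc i) = begin
    (K * a + b) * (2 * 2 ^ K)                    ≡⟨ expand K a b (2 ^ K) ⟩
    2 * K * (a * 2 ^ K) + 2 * (b * 2 ^ K)        ≤⟨ +-mono-≤ (*-monoʳ-≤ (2 * K) (stirling1*2^≤ K (suc i)))
                                                             (*-monoʳ-≤ 2 (stirling1*2^≤ K i)) ⟩
    2 * K * (2 ^ suc i * o) + 2 * (2 ^ i * o)    ≡⟨ collect K (2 ^ i) o ⟩
    2 ^ suc i * oddProduct (suc K)               ∎
    where
    open ≤-Reasoning
    a = stirling1 K (suc i)
    b = stirling1 K i
    o = oddProduct K
    expand : ∀ K a b x → (K * a + b) * (2 * x) ≡ 2 * K * (a * x) + 2 * (b * x)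
    expand = solve-∀
    collect : ∀ K y o → 2 * K * (2 * y * o) + 2 * (y * o) ≡ 2 * y * (o * suc (2 * K))
    collect = solve-∀

  wallis-inequality : ∀ K → oddProduct K * oddProduct K * suc (2 * K) ≤ (2 ^ K * K !) * (2 ^ K * K !)
  wallis-inequality zero    = ≤-refl
  wallis-inequality (suc K) = begin
    (o * s) * (o * s) * suc (2 * suc K)          ≡⟨ regroup o s (suc (2 * suc K)) ⟩
    (o * o * s) * (s * suc (2 * suc K))          ≤⟨ *-mono-≤ (wallis-inequality K) (consecutive-odd K) ⟩
    (e * e) * (suc (suc (2 * K)) * suc (suc (2 * K)))  ≡⟨ double (2 ^ K) (K !) K ⟩
    (2 ^ suc K * suc K !) * (2 ^ suc K * suc K !)    ∎
    where
    open ≤-Reasoning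
    o = oddProduct K
    s = suc (2 * K)
    e = 2 ^ K * K !
    regroup : ∀ o a b → o * a * (o * a) * b ≡ (o * o * a) * (a * b)
    regroup = solve-∀
    consecutive-odd : ∀ K → suc (2 * K) * suc (2 * suc K) ≤ suc (suc (2 * K)) * suc (suc (2 * K))
    consecutive-odd K = ≤-trans (≤-reflexive (lhs K)) (≤-trans (n≤1+n _) (≤-reflexive (rhs K)))
      where
      lhs : ∀ K → suc (2 * K) * suc (2 * suc K) ≡ 4 * K * K + 8 * K + 3
      lhs = solve-∀
      rhs : ∀ K → suc (4 * K * K + 8 * K + 3) ≡ suc (suc (2 * K)) * suc (suc (2 * K))
      rhs = solve-∀
    double : ∀ t f K → t * f * (t * f) * (suc (suc (2 * K)) * suc (suc (2 * K)))
                     ≡ 2 * t * (suc K * f) * (2 * t * (suc K * f))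
    double = solve-∀

  m*m≤n*n⇒m≤n : ∀ m n → m * m ≤ n * n → m ≤ n
  m*m≤n*n⇒m≤n m n m*m≤n*n with m ≤? n
  ... | yes m≤n = m≤n
  ... | no  m≰n = contradiction m*m≤n*n (<⇒≱ (*-mono-< (≰⇒> m≰n) (≰⇒> m≰n)))

  stirling1-small : ∀ K i c → (2 ^ i * c) * (2 ^ i * c) ≤ suc (2 * K) → stirling1 K i * c ≤ K !
  stirling1-small K i c small = *-cancelʳ-≤ (stirling1 K i * c) (K !) (2 ^ K) {{m^n≢0 2 K}} (begin
    stirling1 K i * c * 2 ^ K       ≡⟨ swap (stirling1 K i) c (2 ^ K) ⟩
    stirling1 K i * 2 ^ K * c       ≤⟨ *-monoˡ-≤ c (stirling1*2^≤ K i) ⟩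
    2 ^ i * o * c                   ≡⟨ swap (2 ^ i) o c ⟩
    2 ^ i * c * o                   ≤⟨ m*m≤n*n⇒m≤n (2 ^ i * c * o) (2 ^ K * K !) squares ⟩
    2 ^ K * K !                     ≡⟨ *-comm (2 ^ K) (K !) ⟩
    K ! * 2 ^ K                     ∎)
    where
    open ≤-Reasoning
    o = oddProduct K
    C = 2 ^ i * c
    swap : ∀ a b c → a * b * c ≡ a * c * b
    swap = solve-∀
    squares : C * o * (C * o) ≤ (2 ^ K * K !) * (2 ^ K * K !)
    squares = begin
      C * o * (C * o)                 ≡⟨ regroup C o ⟩
      C * C * (o * o)                 ≤⟨ *-monoˡ-≤ (o * o) small ⟩
      suc (2 * K) * (o * o)           ≡⟨ *-comm (suc (2 * K)) (o * o) ⟩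
      o * o * suc (2 * K)             ≤⟨ wallis-inequality K ⟩
      (2 ^ K * K !) * (2 ^ K * K !)   ∎
      where
      regroup : ∀ a b → a * b * (a * b) ≡ a * a * (b * b)
      regroup = solve-∀

  rising≢0 : ∀ k p → NonZero (rising (suc k) p)
  rising≢0 k zero    = _
  rising≢0 k (suc p) = m*n≢0 (rising (suc k) p) (suc k + suc p) {{rising≢0 k p}}

  rising*! : ∀ k p → rising (suc k) p * k ! ≡ (suc k + p) !
  rising*! k zero    = cong _! (sym (+-identityʳ (suc k)))
  rising*! k (suc p) = begin
    rising (suc k) p * (suc k + suc p) * k !          ≡⟨ swap (rising (suc k) p) (suc k + suc p) (k !) ⟩
    (suc k + suc p) * (rising (suc k) p * k !)        ≡⟨ cong₂ _*_ (+-suc (suc k) p) (rising*! k p) ⟩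
    suc (suc k + p) * (suc k + p) !                   ≡⟨ cong _! (sym (+-suc (suc k) p)) ⟩
    (suc k + suc p) !                                 ∎
    where
    open ≡-Reasoning
    swap : ∀ a b c → a * b * c ≡ b * (a * c)
    swap = solve-∀

  -- (k + 3) ⋯ (k + q + 2) ≥ 3 ⋯ (q + 2) = (q + 2)! / 2
  rising-≥ : ∀ k q → suc k * suc (suc k) * suc (suc q) ! ≤ 2 * rising (suc k) (suc q)
  rising-≥ k zero    = ≤-reflexive (base k)
    where
    base : ∀ k → suc k * suc (suc k) * (2 * 1) ≡ 2 * (suc k * (suc k + 1))
    base = solve-∀
  rising-≥ k (suc q) = begin
    a * (suc (suc (suc q)) * suc (suc q) !)       ≡⟨ swap (suc k * suc (suc k)) (suc (suc (suc q))) (suc (suc q) !) ⟩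
    a * suc (suc q) ! * suc (suc (suc q))          ≤⟨ *-mono-≤ (rising-≥ k q) (s≤s (m≤n+m (suc (suc q)) k)) ⟩
    2 * rising (suc k) (suc q) * (suc k + suc (suc q)) ≡⟨ *-assoc 2 (rising (suc k) (suc q)) _ ⟩
    2 * rising (suc k) (suc (suc q))               ∎
    where
    open ≤-Reasoning
    a = suc k * suc (suc k)
    swap : ∀ a b c → a * (b * c) ≡ a * c * b
    swap = solve-∀

module Hurwitz where

  open Fraction
  open Approximation
  open FiniteSum
  open import Data.Nat
  open import Data.Nat.Properties
  open import Data.Nat.Tactic.RingSolver using (solve-∀)
  import Data.Rational as ℚ
  import Data.Rational.Properties as ℚ
  open import Data.Rational.Solver using (module +-*-Solver)
  open import Relation.Binary.PropositionalEquality
  open +-*-Solver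

  hurwitz-step : ∀ s a t → 1 ÷ ((t + suc a) ^ suc (suc s)) ℚ.+ 2 ÷ suc (suc t) ℚ.≤ 2 ÷ suc t
  hurwitz-step s a t = ℚ.≤-trans (ℚ.+-monoˡ-≤ (2 ÷ suc (suc t)) term≤)
    (ℚ.≤-reflexive (subst₂ (λ x y → 2 ÷ (1 * (suc t * suc (suc t))) ℚ.+ 2 ÷ x ≡ 2 ÷ y)
      (*-identityˡ (suc (suc t))) (*-identityˡ (suc t)) (÷-partial-fractions 2 1 t)))
    where
    base = t + suc a
    instance
      base≢0 : NonZero base
      base≢0 = subst NonZero (sym (+-suc t a)) _
    t<base : suc t ≤ base
    t<base = subst (suc t ≤_) (sym (+-suc t a)) (s≤s (m≤m+n t a))
    term≤ : 1 ÷ (base ^ suc (suc s)) ℚ.≤ 2 ÷ (1 * (suc t * suc (suc t)))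
    term≤ = ÷-mono-≤ 1 (base ^ suc (suc s)) 2 _ {{m^n≢0 base (suc (suc s))}} {{m*n≢0 1 _}} (begin
      1 * (1 * (suc t * suc (suc t)))          ≡⟨ trans (*-identityˡ _) (*-identityˡ _) ⟩
      suc t * suc (suc t)                      ≤⟨ m≤m+n _ (t * suc t) ⟩
      suc t * suc (suc t) + t * suc t          ≡⟨ square t ⟩
      2 * (suc t * suc t)                      ≤⟨ *-monoʳ-≤ 2 (*-mono-≤ t<base t<base) ⟩
      2 * (base * base)                        ≡⟨ cong (λ x → 2 * (base * x)) (sym (*-identityʳ base)) ⟩
      2 * base ^ 2                             ≤⟨ *-monoʳ-≤ 2 (^-monoʳ-≤ base {2} {suc (suc s)} (s≤s (s≤s z≤n))) ⟩
      2 * base ^ suc (suc s)                   ∎)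
      where
      open ≤-Reasoning
      square : ∀ t → suc t * suc (suc t) + t * suc t ≡ 2 * (suc t * suc t)
      square = solve-∀

  hurwitz-cauchy : ∀ s a {N K} → N ≤ K →
    hurwitzPartial (suc (suc s)) (suc a) N ≈[ 2 ÷ suc N ] hurwitzPartial (suc (suc s)) (suc a) K
  hurwitz-cauchy s a = sum-tail-≈ (hurwitz-step s a)
    (λ t → 0≤÷ 1 ((t + suc a) ^ suc (suc s))) (λ t → 0≤÷ 2 (suc t))

  hurwitz-zeta : ∀ s n K → hurwitzPartial s (suc n) K ≡ zetaPartial s (n + K) ℚ.- harmonic s n
  hurwitz-zeta s n K = sym (begin
    zetaPartial s (n + K) ℚ.- H                  ≡⟨ cong (ℚ._- H) (sum-split n K (λ j → 1 ÷ (suc j ^ s))) ⟩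
    (H ℚ.+ shifted) ℚ.- H                        ≡⟨ solve 2 (λ H S → (H :+ S) :- H := S) refl H shifted ⟩
    shifted                                      ≡⟨ sum-cong K (λ j _ → cong (λ x → 1 ÷ (x ^ s)) (trans (+-suc j n) (cong suc (+-comm j n)))) ⟨
    hurwitzPartial s (suc n) K                   ∎)
    where
    open ≡-Reasoning
    H = harmonic s n
    shifted = sumBelow K (λ j → 1 ÷ (suc (n + j) ^ s))

  zeta-hurwitz : ∀ s K → zetaPartial s K ≡ hurwitzPartial s 1 K
  zeta-hurwitz s K = sum-cong K (λ j _ → cong (λ x → 1 ÷ (x ^ s)) (+-comm 1 j))

module StirlingTerms where

  open Fraction
  open StirlingBounds
  open import Data.Nat
  open import Data.Nat.Properties
  open import Data.Nat.Tactic.RingSolver using (solve-∀)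
  import Data.Rational as ℚ
  open import Relation.Binary.PropositionalEquality

  term : ℕ → ℕ → ℕ → ℚ.ℚ
  term p j k = (p ! * stirling1 k j) ÷ (rising k p * k !)

  -- [k, j] / k! times the Beta integral B(k + 1, p + 1) = p! k! / (k + p + 1)!
  beta : ℕ → ℕ → ℕ → ℚ.ℚ
  beta p j k = (p ! * stirling1 k j) ÷ (suc (k + p) !)

  boundary : ℕ → ℕ → ℕ → ℚ.ℚ
  boundary p j K = (p ! * stirling1 K j) ÷ ((K + p) !)

  0≤term : ∀ p j k → ℚ.0ℚ ℚ.≤ term p j k
  0≤term p j k = 0≤÷ (p ! * stirling1 k j) (rising k p * k !)

  0≤boundary : ∀ p j K → ℚ.0ℚ ℚ.≤ boundary p j K
  0≤boundary p j K = 0≤÷ (p ! * stirling1 K j) ((K + p) !)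

  term-split : ∀ p j k → term p (suc j) k ≡ beta p (suc j) k ℚ.+ term (suc p) (suc j) k
  term-split p j zero = trans (0÷ _ (rising 0 p * 1) (*-zeroʳ (p !)))
    (sym (cong₂ ℚ._+_ (0÷ _ (suc p !) (*-zeroʳ (p !))) (0÷ _ (rising 0 (suc p) * 1) (*-zeroʳ (suc p !)))))
  term-split p j (suc k) = sym (trans (÷-+-÷ (P * S) D₁ (suc p ! * S) D₂) (÷-≡ _ (D₁ * D₂) (P * S) (R * suc k !) cross))
    where
    P = p !
    S = stirling1 (suc k) (suc j)
    R = rising (suc k) p
    D₁ = suc (suc k + p) !
    D₂ = R * (suc k + suc p) * suc k !
    instance
      R≢0 : NonZero R
      R≢0 = rising≢0 k p
      k!≢0 : NonZero (suc k !)
      k!≢0 = suc k !≢0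
      D₁≢0 : NonZero D₁
      D₁≢0 = suc (suc k + p) !≢0
      D₂≢0 : NonZero D₂
      D₂≢0 = m*n≢0 (R * (suc k + suc p)) (suc k !) {{m*n≢0 R (suc k + suc p)}}
      Rk!≢0 : NonZero (R * suc k !)
      Rk!≢0 = m*n≢0 R (suc k !)
      D₁₂≢0 : NonZero (D₁ * D₂)
      D₁₂≢0 = m*n≢0 D₁ D₂
    polynomial : ∀ P S R f k p →
      (P * S * (R * (suc k + suc p) * (suc k * f)) + suc p * P * S * (suc (suc k + p) * (R * f))) * (R * (suc k * f))
      ≡ P * S * ((suc (suc k + p) * (R * f)) * (R * (suc k + suc p) * (suc k * f)))
    polynomial = solve-∀
    -- polynomial once (k + p + 1)! is written as R · k!
    cross : (P * S * D₂ + suc p ! * S * D₁) * (R * suc k !) ≡ P * S * (D₁ * D₂)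
    cross = subst (λ F → (P * S * D₂ + suc p ! * S * (suc (suc k + p) * F)) * (R * suc k !) ≡ P * S * ((suc (suc k + p) * F) * D₂))
      (rising*! k p) (polynomial P S R (k !) k p)

  -- the Stirling recurrence [K + 1, j + 1] = K [K, j + 1] + [K, j], divided by (K + p + 1)!
  beta-step : ∀ p j K → suc p ÷ 1 ℚ.* beta p (suc j) K ℚ.+ boundary p (suc j) (suc K)
                      ≡ boundary p (suc j) K ℚ.+ beta p j K
  beta-step p j K = begin
    suc p ÷ 1 ℚ.* beta p (suc j) K ℚ.+ boundary p (suc j) (suc K)
      ≡⟨ cong (ℚ._+ boundary p (suc j) (suc K)) (÷-*-÷ (suc p) 1 (P * s₁) D) ⟩
    (suc p * (P * s₁)) ÷ (1 * D) ℚ.+ (P * (K * s₁ + s₀)) ÷ D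
      ≡⟨ ÷-+-÷ _ (1 * D) _ D ⟩
    _ ≡⟨ ÷-≡ _ ((1 * D) * D) _ (F * D) (polynomial P s₁ s₀ K p F) ⟩
    _ ≡⟨ ÷-+-÷ (P * s₁) F (P * s₀) D ⟨
    boundary p (suc j) K ℚ.+ beta p j K ∎
    where
    open ≡-Reasoning
    P = p !
    s₁ = stirling1 K (suc j)
    s₀ = stirling1 K j
    F = (K + p) !
    D = suc (K + p) * F
    instance
      F≢0 : NonZero F
      F≢0 = (K + p) !≢0
      D≢0 : NonZero D
      D≢0 = suc (K + p) !≢0
      1D≢0 : NonZero (1 * D)
      1D≢0 = m*n≢0 1 D
      1DD≢0 : NonZero (1 * D * D)
      1DD≢0 = m*n≢0 (1 * D) D
      FD≢0 : NonZero (F * D)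
      FD≢0 = m*n≢0 F D
    polynomial : ∀ P s₁ s₀ K p F →
      (suc p * (P * s₁) * (suc (K + p) * F) + P * (K * s₁ + s₀) * (1 * (suc (K + p) * F))) * (F * (suc (K + p) * F))
      ≡ (P * s₁ * (suc (K + p) * F) + P * s₀ * F) * ((1 * (suc (K + p) * F)) * (suc (K + p) * F))
    polynomial = solve-∀

  term-≤ : ∀ q j t → term (suc q) j (suc t) ℚ.≤ 2 ÷ (suc (suc q) * (suc t * suc (suc t)))
  term-≤ q j t = ÷-mono-≤ _ (R * suc t !) 2 _ {{m*n≢0 R (suc t !) {{rising≢0 t (suc q)}} {{suc t !≢0}}}} (begin
    suc q ! * s * (Q * (suc t * suc (suc t)))           ≤⟨ *-monoˡ-≤ (Q * (suc t * suc (suc t))) (*-monoʳ-≤ (suc q !) (stirling1≤! (suc t) j)) ⟩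
    suc q ! * suc t ! * (Q * (suc t * suc (suc t)))     ≡⟨ regroup (suc q !) (suc t !) Q (suc t) (suc (suc t)) ⟩
    suc t ! * (suc t * suc (suc t) * (Q * suc q !))     ≤⟨ *-monoʳ-≤ (suc t !) (rising-≥ t q) ⟩
    suc t ! * (2 * R)                                   ≡⟨ regroup₂ (suc t !) R ⟩
    2 * (R * suc t !)                                   ∎)
    where
    open ≤-Reasoning
    Q = suc (suc q)
    R = rising (suc t) (suc q)
    s = stirling1 (suc t) j
    regroup : ∀ a b c d f → a * b * (c * (d * f)) ≡ b * (d * f * (c * a))
    regroup = solve-∀
    regroup₂ : ∀ a b → a * (2 * b) ≡ 2 * (b * a)
    regroup₂ = solve-∀

  boundary-small : ∀ p i K c .{{_ : NonZero c}} → (2 ^ i * c) * (2 ^ i * c) ≤ suc (2 * K) →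
                   boundary p i K ℚ.≤ 1 ÷ c
  boundary-small p i K c small = ÷-mono-≤ _ ((K + p) !) 1 c {{(K + p) !≢0}} (begin
    p ! * stirling1 K i * c         ≡⟨ *-assoc (p !) (stirling1 K i) c ⟩
    p ! * (stirling1 K i * c)       ≤⟨ *-monoʳ-≤ (p !) (stirling1-small K i c small) ⟩
    p ! * K !                       ≤⟨ !*!≤! p K ⟩
    (K + p) !                       ≡⟨ *-identityˡ ((K + p) !) ⟨
    1 * (K + p) !                   ∎)
    where open ≤-Reasoning

module Expansion where

  open Fraction
  open Approximation
  open FiniteSum
  open StirlingBounds using (stirling1-<)
  open StirlingTerms
  open import Data.Nat as ℕ using (ℕ; zero; suc; _!; _^_)
  import Data.Nat.Properties as ℕ
  open import Data.Nat.Tactic.RingSolver using (solve-∀)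
  open import Data.Rational using (ℚ; 0ℚ; 1ℚ; _+_; _*_; _≤_; NonNegative; nonNegative)
  open import Data.Rational.Properties
  open import Data.Rational.Solver using (module +-*-Solver)
  open import Data.Product using (_,_)
  open import Relation.Binary.PropositionalEquality
  open +-*-Solver

  -- truncation of ∫₀¹ (1 − x)ᵖ (− ln (1 − x))ʲ / j! dx = (p + 1)^−(j+1)
  betaSum : ℕ → ℕ → ℕ → ℚ
  betaSum p j K = sumBelow K (beta p j)

  betaSum-step : ∀ p j K → suc p ÷ 1 * betaSum p (suc j) K + boundary p (suc j) K ≡ betaSum p j K
  betaSum-step p j zero    = trans (cong₂ _+_ (*-zeroʳ (suc p ÷ 1)) (0÷ _ (p !) (ℕ.*-zeroʳ (p !)))) (+-identityʳ 0ℚ)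
  betaSum-step p j (suc K) = begin
    c * (E + b₁) + x′      ≡⟨ solve 4 (λ c E b₁ x′ → c :* (E :+ b₁) :+ x′ := c :* E :+ (c :* b₁ :+ x′)) refl c E b₁ x′ ⟩
    c * E + (c * b₁ + x′)  ≡⟨ cong (c * E +_) (beta-step p j K) ⟩
    c * E + (x + b₀)       ≡⟨ +-assoc (c * E) x b₀ ⟨
    (c * E + x) + b₀       ≡⟨ cong (_+ b₀) (betaSum-step p j K) ⟩
    betaSum p j K + b₀     ∎
    where
    open ≡-Reasoning
    c = suc p ÷ 1
    E = betaSum p (suc j) K
    b₁ = beta p (suc j) K
    b₀ = beta p j K
    x = boundary p (suc j) K
    x′ = boundary p (suc j) (suc K)

  betaSum-zero : ∀ p K → betaSum p 0 (suc K) ≡ 1 ÷ suc p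
  betaSum-zero p zero    = trans (+-identityˡ _) (÷-≡ (p ! ℕ.* 1) (suc p !) 1 (suc p) {{suc p ℕ.!≢0}} (cross (p !) p))
    where
    cross : ∀ f p → f ℕ.* 1 ℕ.* suc p ≡ 1 ℕ.* (suc p ℕ.* f)
    cross = solve-∀
  betaSum-zero p (suc K) = trans (cong₂ _+_ (betaSum-zero p K) (0÷ _ (suc (suc K ℕ.+ p) !) (ℕ.*-zeroʳ (p !))))
    (+-identityʳ _)

  betaSum-identity : ∀ p j K → (suc p ^ suc j) ÷ 1 * betaSum p j (suc K)
    + sumBelow j (λ i → (suc p ^ suc i) ÷ 1 * boundary p (suc i) (suc K)) ≡ 1ℚ
  betaSum-identity p zero    K = trans (+-identityʳ _) (trans (cong ((suc p ^ 1) ÷ 1 *_) (betaSum-zero p K))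
    (trans (÷-*-÷ (suc p ^ 1) 1 1 (suc p)) (÷-≡ (suc p ^ 1 ℕ.* 1) (1 ℕ.* suc p) 1 1 (cross p))))
    where
    cross : ∀ p → suc p ℕ.* 1 ℕ.* 1 ℕ.* 1 ≡ 1 ℕ.* (1 ℕ.* suc p)
    cross = solve-∀
  betaSum-identity p (suc j) K = begin
    u′ * E′ + (S + u * x′)       ≡⟨ cong (λ v → v * E′ + (S + u * x′)) (÷-*-÷ (suc p) 1 (suc p ^ suc j) 1) ⟨
    (c * u) * E′ + (S + u * x′)  ≡⟨ solve 5 (λ c u E′ S x′ → (c :* u) :* E′ :+ (S :+ u :* x′) := u :* (c :* E′ :+ x′) :+ S)
                                      refl c u E′ S x′ ⟩
    u * (c * E′ + x′) + S        ≡⟨ cong (λ E → u * E + S) (betaSum-step p j (suc K)) ⟩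
    u * E + S                    ≡⟨ betaSum-identity p j K ⟩
    1ℚ                           ∎
    where
    open ≡-Reasoning
    c = suc p ÷ 1
    u = (suc p ^ suc j) ÷ 1
    u′ = (suc p ^ suc (suc j)) ÷ 1
    E = betaSum p j (suc K)
    E′ = betaSum p (suc j) (suc K)
    x′ = boundary p (suc j) (suc K)
    S = sumBelow j (λ i → (suc p ^ suc i) ÷ 1 * boundary p (suc i) (suc K))

  betaSum-≈ : ∀ p j K → betaSum p j (suc K) ≈[ sumBelow j (λ i → boundary p (suc i) (suc K)) ] 1 ÷ (suc p ^ suc j)
  betaSum-≈ p j K = ≤-trans E≤w (p≤p+q 0≤D) , w≤E+D
    where
    open ≤-Reasoning
    X = suc p ^ suc j
    u : ℕ → ℚ
    u i = (suc p ^ suc i) ÷ 1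
    x : ℕ → ℚ
    x i = boundary p (suc i) (suc K)
    w = 1 ÷ X
    E = betaSum p j (suc K)
    B = sumBelow j (λ i → u i * x i)
    D = sumBelow j x
    instance
      X≢0 : ℕ.NonZero X
      X≢0 = ℕ.m^n≢0 (suc p) (suc j)
      w≥0 : NonNegative w
      w≥0 = nonNegative (0≤÷ 1 X)
    0≤x : ∀ i → 0ℚ ≤ x i
    0≤x i = 0≤boundary p (suc i) (suc K)
    0≤D : 0ℚ ≤ D
    0≤D = 0≤sum j 0≤x
    0≤B : 0ℚ ≤ B
    0≤B = 0≤sum j (λ i → ≤-trans (≤-reflexive (sym (*-zeroʳ (u i)))) (*-monoˡ-≤-nonNeg (u i) {{nonNegative (0≤÷ (suc p ^ suc i) 1)}} (0≤x i)))
    w*u≤1 : ∀ i → i ℕ.< j → w * u i ≤ 1ℚ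
    w*u≤1 i i<j = ÷-inverseˡ-≤ (suc p ^ suc i) X (ℕ.^-monoʳ-≤ (suc p) (ℕ.s≤s (ℕ.<⇒≤ i<j)))
    cancel : w * (u j * E) ≡ E
    cancel = trans (sym (*-assoc w (u j) E)) (trans (cong (_* E) (÷-inverseˡ X)) (*-identityˡ E))
    E≤w : E ≤ w
    E≤w = begin
      E                  ≡⟨ cancel ⟨
      w * (u j * E)      ≤⟨ *-monoˡ-≤-nonNeg w (p≤p+q 0≤B) ⟩
      w * (u j * E + B)  ≡⟨ cong (w *_) (betaSum-identity p j K) ⟩
      w * 1ℚ             ≡⟨ *-identityʳ w ⟩
      w                  ∎
    w≤E+D : w ≤ E + D
    w≤E+D = begin
      w                                      ≡⟨ trans (cong (w *_) (betaSum-identity p j K)) (*-identityʳ w) ⟨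
      w * (u j * E + B)                      ≡⟨ *-distribˡ-+ w (u j * E) B ⟩
      w * (u j * E) + w * B                  ≡⟨ cong₂ _+_ cancel (*-distribˡ-sum w j _) ⟩
      E + sumBelow j (λ i → w * (u i * x i)) ≤⟨ +-monoʳ-≤ E (sum-mono j scaled≤) ⟩
      E + D                                  ∎
      where
      scaled≤ : ∀ i → i ℕ.< j → w * (u i * x i) ≤ x i
      scaled≤ i i<j = begin
        w * (u i * x i)  ≡⟨ *-assoc w (u i) (x i) ⟨
        (w * u i) * x i  ≤⟨ *-monoʳ-≤-nonNeg (x i) {{nonNegative (0≤x i)}} (w*u≤1 i i<j) ⟩
        1ℚ * x i         ≡⟨ *-identityˡ (x i) ⟩
        x i              ∎

  lhsPartial≡sum-term : ∀ n m K → lhsPartial n m K ≡ sumBelow (m ℕ.+ K) (term n m)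
  lhsPartial≡sum-term n m K = sym (trans (sum-split m K (term n m)) (trans (cong (_+ lhsPartial n m K) below-m) (+-identityˡ _)))
    where
    below-m : sumBelow m (term n m) ≡ 0ℚ
    below-m = trans (sum-cong m (λ k k<m → 0÷ (n ! ℕ.* stirling1 k m) (rising k n ℕ.* k !) (trans (cong (n ! ℕ.*_) (stirling1-< k<m)) (ℕ.*-zeroʳ (n !)))))
                    (sum-zero m)

  term-telescope : ∀ n j J K → sumBelow K (term n (suc j))
    ≡ sumBelow J (λ i → betaSum (n ℕ.+ i) (suc j) K) + sumBelow K (term (n ℕ.+ J) (suc j))
  term-telescope n j zero    K = trans (cong (λ p → sumBelow K (term p (suc j))) (sym (ℕ.+-identityʳ n))) (sym (+-identityˡ _))
  term-telescope n j (suc J) K = begin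
    sumBelow K (term n (suc j))                                      ≡⟨ term-telescope n j J K ⟩
    B + sumBelow K (term p (suc j))                                  ≡⟨ cong (B +_) split ⟩
    B + (betaSum p (suc j) K + sumBelow K (term (suc p) (suc j)))    ≡⟨ +-assoc B _ _ ⟨
    (B + betaSum p (suc j) K) + sumBelow K (term (suc p) (suc j))    ≡⟨ cong (λ q → (B + betaSum p (suc j) K) + sumBelow K (term q (suc j))) (sym (ℕ.+-suc n J)) ⟩
    (B + betaSum p (suc j) K) + sumBelow K (term (n ℕ.+ suc J) (suc j)) ∎
    where
    open ≡-Reasoning
    p = n ℕ.+ J
    B = sumBelow J (λ i → betaSum (n ℕ.+ i) (suc j) K)
    split : sumBelow K (term p (suc j)) ≡ betaSum p (suc j) K + sumBelow K (term (suc p) (suc j))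
    split = trans (sum-cong K (λ k _ → term-split p j k)) (sum-+ K (beta p (suc j)) (term (suc p) (suc j)))

  term-tail : ∀ q j K → sumBelow K (term (suc q) (suc j)) ≤ 2 ÷ suc (suc q)
  term-tail q j zero    = 0≤÷ 2 (suc (suc q))
  term-tail q j (suc K) = begin
    sumBelow (suc K) T                           ≡⟨ sum-split 1 K T ⟩
    (0ℚ + T 0) + sumBelow K (λ t → T (suc t))    ≡⟨ cong (λ z → (0ℚ + z) + sumBelow K (λ t → T (suc t))) (0÷ (suc q ! ℕ.* 0) (rising 0 (suc q) ℕ.* 1) (ℕ.*-zeroʳ (suc q !))) ⟩
    0ℚ + sumBelow K (λ t → T (suc t))            ≡⟨ +-identityˡ _ ⟩
    sumBelow K (λ t → T (suc t))                 ≤⟨ p≤p+q (0≤÷ 2 (Q ℕ.* suc K)) ⟩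
    sumBelow K (λ t → T (suc t)) + g K           ≤⟨ sum-telescope step 0 K ⟩
    0ℚ + g 0                                     ≡⟨ trans (+-identityˡ _) (cong (2 ÷_) (ℕ.*-identityʳ Q)) ⟩
    2 ÷ Q                                        ∎
    where
    open ≤-Reasoning
    Q = suc (suc q)
    T = term (suc q) (suc j)
    g : ℕ → ℚ
    g t = 2 ÷ (Q ℕ.* suc t)
    step : ∀ t → T (suc t) + g (suc t) ≤ g t
    step t = ≤-trans (+-monoˡ-≤ (g (suc t)) (term-≤ q (suc j) t)) (≤-reflexive (÷-partial-fractions 2 Q t))

module Convergence where

  open Fraction
  open Approximation
  open FiniteSum
  open StirlingTerms
  open Expansion
  open Hurwitz
  open import Data.Nat as ℕ using (suc; _^_; NonZero)
  import Data.Nat.Properties as ℕ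
  open import Data.Nat.Tactic.RingSolver using (solve-∀)
  open import Data.Rational using (_+_; _-_; _≤_)
  open import Data.Rational.Properties
  open import Data.Product using (_,_; ∃)
  open import Relation.Binary.PropositionalEquality

  boundary-errors-small : ∀ n m J Z K .{{_ : NonZero m}} .{{_ : NonZero J}} .{{_ : NonZero Z}} →
    let C = 2 ^ m ℕ.* (m ℕ.* (J ℕ.* Z)) in C ℕ.* C ℕ.≤ suc (2 ℕ.* K) →
    sumBelow J (λ j → sumBelow m (λ i → boundary (n ℕ.+ j) (suc i) K)) ≤ 1 ÷ Z
  boundary-errors-small n m J Z K {{m≢0}} {{J≢0}} {{Z≢0}} small = begin
    sumBelow J (λ j → sumBelow m (λ i → boundary (n ℕ.+ j) (suc i) K))
      ≤⟨ sum-mono J (λ j _ → sum-mono m (λ i i<m → boundary-small (n ℕ.+ j) (suc i) K c {{c≢0}} (ℕ.≤-trans (square-mono i<m) small))) ⟩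
    sumBelow J (λ _ → sumBelow m (λ _ → 1 ÷ (m ℕ.* (J ℕ.* Z))))
      ≡⟨ sum-cong J (λ _ _ → sum-const-÷ m 1 (J ℕ.* Z) {{m≢0}} {{JZ≢0}}) ⟩
    sumBelow J (λ _ → 1 ÷ (J ℕ.* Z))
      ≡⟨ sum-const-÷ J 1 Z ⟩
    1 ÷ Z ∎
    where
    open ≤-Reasoning
    c = m ℕ.* (J ℕ.* Z)
    JZ≢0 : NonZero (J ℕ.* Z)
    JZ≢0 = ℕ.m*n≢0 J Z {{J≢0}} {{Z≢0}}
    c≢0 : NonZero c
    c≢0 = ℕ.m*n≢0 m (J ℕ.* Z) {{m≢0}} {{JZ≢0}}
    square-mono : ∀ {i} → i ℕ.< m → (2 ^ suc i ℕ.* c) ℕ.* (2 ^ suc i ℕ.* c) ℕ.≤ (2 ^ m ℕ.* c) ℕ.* (2 ^ m ℕ.* c)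
    square-mono i<m = ℕ.*-mono-≤ factor factor
      where factor = ℕ.*-monoˡ-≤ c (ℕ.^-monoʳ-≤ 2 i<m)

  lhs-≈ : ∀ n m J K → suc J ℕ.≤ K →
    lhsPartial n (suc m) K
      ≈[ (2 ÷ suc (suc J) + sumBelow (suc J) (λ j → sumBelow (suc m) (λ i → boundary (n ℕ.+ j) (suc i) (suc m ℕ.+ K))))
         + 2 ÷ suc (suc J) ]
    hurwitzPartial (suc (suc m)) (suc n) K
  lhs-≈ n m J K J<K = subst (_≈[ (2 ÷ suc (suc J) + D) + 2 ÷ suc (suc J) ] hurwitzPartial (suc (suc m)) (suc n) K) (sym lhs≡X+Y)
    (≈-trans (≈-trans (+≈ (0≤sum K′ (0≤term (n ℕ.+ suc J) (suc m))) Y≤) X≈) (hurwitz-cauchy m n J<K))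
    where
    K′ = suc m ℕ.+ K
    X = sumBelow (suc J) (λ j → betaSum (n ℕ.+ j) (suc m) K′)
    Y = sumBelow K′ (term (n ℕ.+ suc J) (suc m))
    D = sumBelow (suc J) (λ j → sumBelow (suc m) (λ i → boundary (n ℕ.+ j) (suc i) K′))
    lhs≡X+Y : lhsPartial n (suc m) K ≡ X + Y
    lhs≡X+Y = trans (lhsPartial≡sum-term n (suc m) K) (term-telescope n m (suc J) K′)
    Y≤ : Y ≤ 2 ÷ suc (suc J)
    Y≤ = ≤-trans (≤-reflexive (cong (λ p → sumBelow K′ (term p (suc m))) (ℕ.+-suc n J)))
      (≤-trans (term-tail (n ℕ.+ J) m K′)
        (÷-mono-≤ 2 (suc (suc (n ℕ.+ J))) 2 (suc (suc J)) (ℕ.*-monoʳ-≤ 2 (ℕ.s≤s (ℕ.s≤s (ℕ.m≤n+m J n))))))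
    X≈ : X ≈[ D ] hurwitzPartial (suc (suc m)) (suc n) (suc J)
    X≈ = sum-≈ (suc J) λ j →
      subst (λ b → betaSum (n ℕ.+ j) (suc m) K′ ≈[ sumBelow (suc m) (λ i → boundary (n ℕ.+ j) (suc i) K′) ] 1 ÷ (b ^ suc (suc m)))
        (trans (cong suc (ℕ.+-comm n j)) (sym (ℕ.+-suc j n))) (betaSum-≈ (n ℕ.+ j) (suc m) (m ℕ.+ K))

  hurwitz-within : ∀ s a M {K L} → 3 ℕ.+ 4 ℕ.* M ℕ.≤ K → 3 ℕ.+ 4 ℕ.* M ℕ.≤ L →
    hurwitzPartial (suc (suc s)) (suc a) K ≈[ 1 ÷ suc M ] hurwitzPartial (suc (suc s)) (suc a) L
  hurwitz-within s a M N≤K N≤L =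
    ≈-weaken (≤-reflexive quarters) (≈-trans (≈-sym (hurwitz-cauchy s a N≤K)) (hurwitz-cauchy s a N≤L))
    where
    N = suc (3 ℕ.+ 4 ℕ.* M)
    cross : ∀ M → (2 ℕ.* (4 ℕ.+ 4 ℕ.* M) ℕ.+ 2 ℕ.* (4 ℕ.+ 4 ℕ.* M)) ℕ.* suc M ≡ 1 ℕ.* ((4 ℕ.+ 4 ℕ.* M) ℕ.* (4 ℕ.+ 4 ℕ.* M))
    cross = solve-∀
    quarters : 2 ÷ N + 2 ÷ N ≡ 1 ÷ suc M
    quarters = trans (÷-+-÷ 2 N 2 N) (÷-≡ (2 ℕ.* N ℕ.+ 2 ℕ.* N) (N ℕ.* N) 1 (suc M) (cross M))

  hurwitz-zeta-within : ∀ s n M {K} → suc (2 ℕ.* M) ℕ.≤ K →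
    hurwitzPartial (suc (suc s)) (suc n) K ≈[ 1 ÷ suc M ] zetaPartial (suc (suc s)) K - harmonic (suc (suc s)) n
  hurwitz-zeta-within s n M {K} N≤K = subst (_≈[ 1 ÷ suc M ] zetaPartial s′ K - harmonic s′ n) (sym (hurwitz-zeta s′ n K))
    (≈-weaken 2/K≤1/M (≈-−ʳ (harmonic s′ n)
      (subst₂ (_≈[ 2 ÷ suc K ]_) (sym (zeta-hurwitz s′ (n ℕ.+ K))) (sym (zeta-hurwitz s′ K))
        (≈-sym (hurwitz-cauchy s 0 (ℕ.m≤n+m K n))))))
    where
    s′ = suc (suc s)
    2/K≤1/M : 2 ÷ suc K ≤ 1 ÷ suc M
    2/K≤1/M = ÷-mono-≤ 2 (suc K) 1 (suc M)
      (ℕ.≤-trans (ℕ.≤-reflexive (double M)) (ℕ.≤-trans (ℕ.s≤s N≤K) (ℕ.≤-reflexive (sym (ℕ.*-identityˡ (suc K))))))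
      where
      double : ∀ M → 2 ℕ.* suc M ≡ suc (suc (2 ℕ.* M))
      double = solve-∀

  lhs-within : ∀ n m M → ∃ λ N → ∀ K → N ℕ.≤ K →
    lhsPartial n (suc m) K ≈[ 1 ÷ suc M ] hurwitzPartial (suc (suc m)) (suc n) K
  lhs-within n m M = suc L ℕ.+ C ℕ.* C , λ K N≤K →
    ≈-weaken (error≤ K N≤K) (lhs-≈ n m L K (ℕ.≤-trans (ℕ.m≤m+n (suc L) (C ℕ.* C)) N≤K))
    where
    -- the two tails 2 / (8 (M + 1)) and the boundary errors ≤ 1 / (2 (M + 1)) add up to 1 / (M + 1)
    L = 6 ℕ.+ 8 ℕ.* M
    Z = 2 ℕ.* suc M
    C = 2 ^ suc m ℕ.* (suc m ℕ.* (suc L ℕ.* Z))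
    a = suc (suc L)
    cross : ∀ M → ((2 ℕ.* (2 ℕ.* suc M) ℕ.+ 1 ℕ.* (8 ℕ.+ 8 ℕ.* M)) ℕ.* (8 ℕ.+ 8 ℕ.* M) ℕ.+ 2 ℕ.* ((8 ℕ.+ 8 ℕ.* M) ℕ.* (2 ℕ.* suc M))) ℕ.* suc M
                  ≡ 1 ℕ.* ((8 ℕ.+ 8 ℕ.* M) ℕ.* (2 ℕ.* suc M) ℕ.* (8 ℕ.+ 8 ℕ.* M))
    cross = solve-∀
    budget : (2 ÷ a + 1 ÷ Z) + 2 ÷ a ≡ 1 ÷ suc M
    budget = trans (cong (_+ 2 ÷ a) (÷-+-÷ 2 a 1 Z))
      (trans (÷-+-÷ (2 ℕ.* Z ℕ.+ 1 ℕ.* a) (a ℕ.* Z) 2 a)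
        (÷-≡ ((2 ℕ.* Z ℕ.+ 1 ℕ.* a) ℕ.* a ℕ.+ 2 ℕ.* (a ℕ.* Z)) (a ℕ.* Z ℕ.* a) 1 (suc M) (cross M)))
    C²≤ : ∀ K → suc L ℕ.+ C ℕ.* C ℕ.≤ K → C ℕ.* C ℕ.≤ suc (2 ℕ.* (suc m ℕ.+ K))
    C²≤ K N≤K = ℕ.≤-trans (ℕ.m≤n+m (C ℕ.* C) (suc L)) (ℕ.≤-trans N≤K (ℕ.≤-trans (ℕ.m≤n+m K (suc m))
      (ℕ.≤-trans (ℕ.m≤m+n (suc m ℕ.+ K) _) (ℕ.n≤1+n _))))
    error≤ : ∀ K → suc L ℕ.+ C ℕ.* C ℕ.≤ K →
      (2 ÷ a + sumBelow (suc L) (λ j → sumBelow (suc m) (λ i → boundary (n ℕ.+ j) (suc i) (suc m ℕ.+ K)))) + 2 ÷ a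
      ≤ 1 ÷ suc M
    error≤ K N≤K = ≤-trans (+-monoˡ-≤ (2 ÷ a) (+-monoʳ-≤ (2 ÷ a)
      (boundary-errors-small n (suc m) (suc L) Z (suc m ℕ.+ K) (C²≤ K N≤K)))) (≤-reflexive budget)

open Approximation using (≈⇒∣-∣≤; archimedean)
open Convergence
open import Data.Nat using (ℕ; suc; _≤_; _+_; _*_; s≤s; z≤n)
open import Data.Product using (_×_; _,_; ∃)
open import Data.Rational using (ℚ; 0ℚ; _<_; _-_; ∣_∣)
open import Data.Rational.Properties using (≤-<-trans)

proposition5p2 : (n m : ℕ) → 1 ≤ m →
    ((ε : ℚ) → 0ℚ < ε → ∃ λ N → (K L : ℕ) → N ≤ K → N ≤ L →
       ∣ hurwitzPartial (suc m) (suc n) K - hurwitzPartial (suc m) (suc n) L ∣ < ε)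
    ×
    ((ε : ℚ) → 0ℚ < ε → ∃ λ N → (K : ℕ) → N ≤ K →
       ∣ lhsPartial n m K - hurwitzPartial (suc m) (suc n) K ∣ < ε)
    ×
    ((ε : ℚ) → 0ℚ < ε → ∃ λ N → (K : ℕ) → N ≤ K →
       ∣ hurwitzPartial (suc m) (suc n) K - (zetaPartial (suc m) K - harmonic (suc m) n) ∣ < ε)
proposition5p2 n (suc m) (s≤s z≤n) = cauchy , lhs-limit , zeta-limit
  where
  cauchy : (ε : ℚ) → 0ℚ < ε → ∃ λ N → (K L : ℕ) → N ≤ K → N ≤ L →
    ∣ hurwitzPartial (suc (suc m)) (suc n) K - hurwitzPartial (suc (suc m)) (suc n) L ∣ < ε
  cauchy ε 0<ε = let M , 1/M<ε = archimedean ε 0<ε in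
    3 + 4 * M , λ K L N≤K N≤L → ≤-<-trans (≈⇒∣-∣≤ (hurwitz-within m n M N≤K N≤L)) 1/M<ε

  lhs-limit : (ε : ℚ) → 0ℚ < ε → ∃ λ N → (K : ℕ) → N ≤ K →
    ∣ lhsPartial n (suc m) K - hurwitzPartial (suc (suc m)) (suc n) K ∣ < ε
  lhs-limit ε 0<ε = let M , 1/M<ε = archimedean ε 0<ε ; N , close = lhs-within n m M in
    N , λ K N≤K → ≤-<-trans (≈⇒∣-∣≤ (close K N≤K)) 1/M<ε

  zeta-limit : (ε : ℚ) → 0ℚ < ε → ∃ λ N → (K : ℕ) → N ≤ K →
    ∣ hurwitzPartial (suc (suc m)) (suc n) K - (zetaPartial (suc (suc m)) K - harmonic (suc (suc m)) n) ∣ < ε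
  zeta-limit ε 0<ε = let M , 1/M<ε = archimedean ε 0<ε in
    suc (2 * M) , λ K N≤K → ≤-<-trans (≈⇒∣-∣≤ (hurwitz-zeta-within m n M N≤K)) 1/M<ε
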